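{- Let $p$ be an odd prime, let $H(p)=N_{\rm ns}(p)\cap N_{\rm sp}(p)$, and let $\pi_{\rm sp}:X_{H(p)}\to X_{\rm sp}^+(p)=X_{N_{\rm sp}(p)}$ be the canonical projection. If $c\in X_{H(p)}(\mathbb{Q}(\zeta_p))$ is a cusp which is not at infinity, then $\pi_{\rm sp}(c)$ is not a cusp at infinity.
   Context: $X(p)$ is the compactified modular curve over $\mathbb{Q}$ classifying $(E,(P,Q))$ with $(P,Q)$ an $\mathbb{F}_p$-basis of $E[p]$; for $H\le\mathrm{GL}_2(\mathbb{F}_p)$, $X_H=H\backslash X(p)$. Fix a generator $\epsilon_p$ of $\mathbb{F}_p^\times$; $C_{\rm ns}(p)=\left\{\begin{pmatrix}a&\epsilon_p b\\ b&a\end{pmatrix}:(a,b)\neq(0,0)\right\}$, $N_{\rm ns}(p)=C_{\rm ns}(p)\cup\mathrm{diag}(1,-1)C_{\rm ns}(p)$; $N_{\rm sp}(p)$ is the group of diagonal and anti-diagonal invertible matrices. Let $M_p=\big((\mathbb{Z}/p\mathbb{Z})^2\setminus\{0\}\big)/\pm1$. The cusps of $X(p)$ are in $\mathrm{GL}_2(\mathbb{F}_p)$-equivariant bijection with $M_p\times\mathbb{F}_p^\times$ (action $g\cdot(v,d)=(gv,\det(g)d)$, via the Deligne–Rapoport description sending the class of $\gamma:(\zeta_p,0)\mapsto(a,b),(1,1)\mapsto(c,d)$ to $((a,b)^T,ad-bc)$), so cusps of $X_H$ correspond to $H\backslash(M_p\times\mathbb{F}_p^\times)$. A cusp of $X_H$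 is \emph{at infinity} if it is represented by $\left(\begin{pmatrix}a\\0\end{pmatrix},a\right)$ for some $a\in\mathbb{F}_p^\times$. -}

module Defs where

open import Data.Nat using (ℕ)
open import Data.Integer using (ℤ; +_; 0ℤ; 1ℤ; _+_; _-_; _*_; -_; _^_)
open import Data.Integer.Divisibility using (_∣_)
open import Data.Product using (Σ; ∃; _×_; _,_)
open import Data.Sum using (_⊎_)
open import Relation.Nullary using (¬_)

-- Elements of F_p are represented by integers; equality in F_p is congruence mod p.
_≡_[mod_] : ℤ → ℤ → ℕ → Set
a ≡ b [mod p ] = (+ p) ∣ (a - b)

NonZeroMod : ℕ → ℤ → Set
NonZeroMod p a = ¬ (a ≡ 0ℤ [mod p ])

IsGenerator : ℕ → ℤ → Set
IsGenerator p ε = NonZeroMod p ε × (∀ x → NonZeroMod p x → ∃ λ (k : ℕ) → (ε ^ k) ≡ x [mod p ])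

record Mat : Set where
  constructor mat
  field
    g11 g12 g21 g22 : ℤ
open Mat public

det : Mat → ℤ
det (mat a b c d) = a * d - b * c

MatEq : ℕ → Mat → Mat → Set
MatEq p (mat a b c d) (mat a' b' c' d') =
  (a ≡ a' [mod p ]) × (b ≡ b' [mod p ]) × (c ≡ c' [mod p ]) × (d ≡ d' [mod p ])

InCns : ℕ → ℤ → Mat → Set
InCns p ε g = ∃ λ a → ∃ λ b → ¬ ((a ≡ 0ℤ [mod p ]) × (b ≡ 0ℤ [mod p ]))
            × MatEq p g (mat a (ε * b) b a)

diag1m1 : Mat
diag1m1 = mat 1ℤ 0ℤ 0ℤ (- 1ℤ)

_·_ : Mat → Mat → Mat
mat a b c d · mat a' b' c' d' = mat (a * a' + b * c') (a * b' + b * d') (c * a' + d * c') (c * b' + d * d')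

InNns : ℕ → ℤ → Mat → Set
InNns p ε g = InCns p ε g ⊎ (∃ λ h → InCns p ε h × MatEq p g (diag1m1 · h))

InNsp : ℕ → Mat → Set
InNsp p g = NonZeroMod p (det g) ×
  (((g12 g ≡ 0ℤ [mod p ]) × (g21 g ≡ 0ℤ [mod p ]))
   ⊎ ((g11 g ≡ 0ℤ [mod p ]) × (g22 g ≡ 0ℤ [mod p ])))

InH : ℕ → ℤ → Mat → Set
InH p ε g = InNns p ε g × InNsp p g

-- Cusp data: an element (v , d) of ((Z/p)^2 \ {0}) × F_p^× (representatives)
record CuspRep : Set where
  constructor cusp
  field
    v₁ v₂ d : ℤ
open CuspRep public

ValidCusp : ℕ → CuspRep → Set
ValidCusp p c = ¬ ((v₁ c ≡ 0ℤ [mod p ]) × (v₂ c ≡ 0ℤ [mod p ])) × NonZeroMod p (d c)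

-- equality in M_p × F_p^×, where M_p = ((Z/p)^2 \ {0}) / ±1
CuspEq : ℕ → CuspRep → CuspRep → Set
CuspEq p (cusp x y e) (cusp x' y' e') =
  (((x ≡ x' [mod p ]) × (y ≡ y' [mod p ])) ⊎ ((x ≡ - x' [mod p ]) × (y ≡ - y' [mod p ])))
  × (e ≡ e' [mod p ])

act : Mat → CuspRep → CuspRep
act g (cusp x y e) = cusp (g11 g * x + g12 g * y) (g21 g * x + g22 g * y) (det g * e)

-- The cusp of X_G represented by c (i.e. the G-orbit of c) is at infinity:
-- the orbit contains ((a,0)^T , a) for some a ∈ F_p^×.
AtInfinity : ℕ → (Mat → Set) → CuspRep → Set
AtInfinity p G c = ∃ λ g → ∃ λ a → G g × NonZeroMod p a × CuspEq p (act g (cusp a 0ℤ a)) c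

{-# OPTIONS --safe #-}
-- The torus T = {diag(t,1)} sends the cusp ((a,0),a) to ((ta,0),ta), so it maps cusps at infinity
-- to cusps at infinity, and N_sp(p) = H(p)·T: diag(x,y) is the scalar y·I times diag(x/y,1), and
-- (0 u; w 0) = (0 εb; b 0)·diag(wε/u,1) with b = u/ε, where y·I and (0 εb; b 0) lie in
-- C_ns(p) ∩ N_sp(p).  So an N_sp(p)-translate of a cusp at infinity is an H(p)-translate of one.
module Submission where

open import Defs
open import Data.Nat using (ℕ)
open import Data.Nat.Primality using (Prime)
open import Data.Integer using (ℤ)
open import Relation.Binary.PropositionalEquality using (_≢_)
open import Relation.Nullary using (¬_)

open import Data.Empty using (⊥-elim)
open import Data.Integer using (+_; -[1+_]; 0ℤ; 1ℤ; _+_; _-_; _*_; -_; ∣_∣)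
import Data.Integer.Divisibility.Signed as Signed
import Data.Integer.Properties as ℤ
open import Data.Integer.Tactic.RingSolver using (solve; solve-∀)
open import Data.List using (_∷_; [])
import Data.Nat.Base as Nat
import Data.Nat.Coprimality as Nat
import Data.Nat.Divisibility as Nat
import Data.Nat.GCD as Nat
import Data.Nat.Primality as Nat
open import Data.Product using (∃; ∃₂; _×_; _,_)
open import Data.Sum using (_⊎_; inj₁; inj₂)
open import Function using (_∘_)
open import Level using (0ℓ)
open import Relation.Binary.Bundles using (Setoid)
open import Relation.Binary.PropositionalEquality
  using (_≡_; refl; sym; trans; cong; subst; module ≡-Reasoning)
import Relation.Binary.Reasoning.Setoid

module Congruence (p : ℕ) where

  -- A record, unlike the bare relation (which only sees ∣ x - y ∣), lets unification recover x, y.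
  infix 4 _≈_
  record _≈_ (x y : ℤ) : Set where
    constructor fromMod
    field toMod : x ≡ y [mod p ]
  open _≈_ public

  private
    difference : ∀ {x y} → x ≈ y → + p Signed.∣ (x - y)
    difference = Signed.∣ᵤ⇒∣ ∘ toMod

    by-difference : ∀ {x y d} → + p Signed.∣ d → x - y ≡ d → x ≈ y
    by-difference p∣d eq = fromMod (Signed.∣⇒∣ᵤ (subst (+ p Signed.∣_) (sym eq) p∣d))

  ≈-reflexive : ∀ {x y} → x ≡ y → x ≈ y
  ≈-reflexive {x} refl = by-difference (Signed.divides 0ℤ refl) (ℤ.+-inverseʳ x)

  ≈-refl : ∀ {x} → x ≈ x
  ≈-refl = ≈-reflexive refl

  ≈-sym : ∀ {x y} → x ≈ y → y ≈ x
  ≈-sym {x} {y} x≈y = by-difference (Signed.∣m⇒∣-m (difference x≈y)) (solve (x ∷ y ∷ []))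

  ≈-trans : ∀ {x y z} → x ≈ y → y ≈ z → x ≈ z
  ≈-trans {x} {y} {z} x≈y y≈z =
    by-difference (Signed.∣m∣n⇒∣m+n (difference x≈y) (difference y≈z)) (solve (x ∷ y ∷ z ∷ []))

  +-cong : ∀ {x y u v} → x ≈ y → u ≈ v → x + u ≈ y + v
  +-cong {x} {y} {u} {v} x≈y u≈v =
    by-difference (Signed.∣m∣n⇒∣m+n (difference x≈y) (difference u≈v)) (solve (x ∷ y ∷ u ∷ v ∷ []))

  *-cong : ∀ {x y u v} → x ≈ y → u ≈ v → x * u ≈ y * v
  *-cong {x} {y} {u} {v} x≈y u≈v =
    by-difference
      (Signed.∣m∣n⇒∣m+n (Signed.∣n⇒∣m*n u (difference x≈y)) (Signed.∣n⇒∣m*n y (difference u≈v)))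
      (solve (x ∷ y ∷ u ∷ v ∷ []))

  neg-cong : ∀ {x y} → x ≈ y → - x ≈ - y
  neg-cong {x} {y} x≈y = by-difference (Signed.∣m⇒∣-m (difference x≈y)) (solve (x ∷ y ∷ []))

  -‿cong : ∀ {x y u v} → x ≈ y → u ≈ v → x - u ≈ y - v
  -‿cong x≈y u≈v = +-cong x≈y (neg-cong u≈v)

  multiple≈0 : ∀ k → k * + p ≈ 0ℤ
  multiple≈0 k = by-difference (Signed.divides k refl) (ℤ.+-identityʳ (k * + p))

  ≈-setoid : Setoid 0ℓ 0ℓ
  ≈-setoid = record
    { Carrier = ℤ
    ; _≈_ = _≈_
    ; isEquivalence = record { refl = ≈-refl ; sym = ≈-sym ; trans = ≈-trans }
    }

  module ≈-Reasoning = Relation.Binary.Reasoning.Setoid ≈-setoid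

  ≈0⇒∣ : ∀ {x} → x ≈ 0ℤ → p Nat.∣ ∣ x ∣
  ≈0⇒∣ {x} = subst (λ y → p Nat.∣ ∣ y ∣) (ℤ.+-identityʳ x) ∘ toMod

  ∣⇒≈0 : ∀ {x} → p Nat.∣ ∣ x ∣ → x ≈ 0ℤ
  ∣⇒≈0 {x} = fromMod ∘ subst (λ y → p Nat.∣ ∣ y ∣) (sym (ℤ.+-identityʳ x))

  infix 4 _≉0
  _≉0 : ℤ → Set
  x ≉0 = ¬ (x ≈ 0ℤ)

  NonZeroMod⇒≉0 : ∀ {x} → NonZeroMod p x → x ≉0
  NonZeroMod⇒≉0 x≢0 = x≢0 ∘ toMod

  ≉0⇒NonZeroMod : ∀ {x} → x ≉0 → NonZeroMod p x
  ≉0⇒NonZeroMod x≉0 = x≉0 ∘ fromMod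

  ≉0-resp : ∀ {x y} → x ≈ y → x ≉0 → y ≉0
  ≉0-resp x≈y x≉0 y≈0 = x≉0 (≈-trans x≈y y≈0)

  ≉0-neg : ∀ {x} → x ≉0 → - x ≉0
  ≉0-neg {x} x≉0 -x≈0 = x≉0 (≈-trans (≈-reflexive (sym (ℤ.neg-involutive x))) (neg-cong -x≈0))

  ≉0-*-invˡ : ∀ {x y} → x * y ≉0 → x ≉0
  ≉0-*-invˡ xy≉0 x≈0 = xy≉0 (*-cong x≈0 ≈-refl)

  ≉0-*-invʳ : ∀ x {y} → x * y ≉0 → y ≉0
  ≉0-*-invʳ x xy≉0 y≈0 = xy≉0 (≈-trans (*-cong (≈-refl {x}) y≈0) (≈-reflexive (ℤ.*-zeroʳ x)))

module PrimeField {p : ℕ} (prime : Prime p) where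

  open Congruence p

  1≉0 : 1ℤ ≉0
  1≉0 (fromMod p∣1) = Nat.nonTrivial⇒≢1 {{Nat.prime⇒nonTrivial prime}} (Nat.∣1⇒≡1 p∣1)

  ≉0-* : ∀ {x y} → x ≉0 → y ≉0 → x * y ≉0
  ≉0-* {x} {y} x≉0 y≉0 xy≈0
    with Nat.euclidsLemma ∣ x ∣ ∣ y ∣ prime (subst (p Nat.∣_) (ℤ.abs-* x y) (≈0⇒∣ {x * y} xy≈0))
  ... | inj₁ p∣x = x≉0 (∣⇒≈0 p∣x)
  ... | inj₂ p∣y = y≉0 (∣⇒≈0 p∣y)

  private
    coprime : ∀ {m} → ¬ (p Nat.∣ m) → Nat.Coprime p m
    coprime p∤m (d∣p , d∣m) with Nat.prime⇒irreducible prime d∣p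
    ... | inj₁ d≡1 = d≡1
    ... | inj₂ refl = ⊥-elim (p∤m d∣m)

    pos-Bézout : ∀ {a b c d} → 1 Nat.+ a Nat.* b ≡ c Nat.* d → 1ℤ + + a * + b ≡ + c * + d
    pos-Bézout {a} {b} {c} {d} eq = begin
      1ℤ + + a * + b         ≡⟨ cong (λ z → 1ℤ + z) (ℤ.pos-* a b) ⟨
      1ℤ + + (a Nat.* b)     ≡⟨ ℤ.pos-+ 1 (a Nat.* b) ⟨
      + (1 Nat.+ a Nat.* b)  ≡⟨ cong +_ eq ⟩
      + (c Nat.* d)          ≡⟨ ℤ.pos-* c d ⟩
      + c * + d              ∎
      where open ≡-Reasoning

    inverse⁺⁻ : ∀ {m a b} → 1ℤ + b * m ≡ a * + p → m * - b ≈ 1ℤ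
    inverse⁺⁻ {m} {a} {b} eq = begin
      m * - b             ≡⟨ solve (m ∷ b ∷ []) ⟩
      1ℤ - (1ℤ + b * m)   ≡⟨ cong (λ z → 1ℤ - z) eq ⟩
      1ℤ - a * + p        ≈⟨ -‿cong (≈-refl {1ℤ}) (multiple≈0 a) ⟩
      1ℤ                  ∎
      where open ≈-Reasoning

    inverse⁻⁺ : ∀ {m a b} → 1ℤ + a * + p ≡ b * m → m * b ≈ 1ℤ
    inverse⁻⁺ {m} {a} {b} eq = begin
      m * b          ≡⟨ ℤ.*-comm m b ⟩
      b * m          ≡⟨ eq ⟨
      1ℤ + a * + p   ≈⟨ +-cong (≈-refl {1ℤ}) (multiple≈0 a) ⟩
      1ℤ             ∎
      where open ≈-Reasoning

    inverse-ℕ : ∀ {m} → ¬ (p Nat.∣ m) → ∃ λ t → + m * t ≈ 1ℤ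
    inverse-ℕ {m} p∤m with Nat.coprime-Bézout (coprime p∤m)
    ... | Nat.Bézout.+- a b eq = - + b , inverse⁺⁻ {+ m} {+ a} {+ b} (pos-Bézout {b} {m} {a} {p} eq)
    ... | Nat.Bézout.-+ a b eq = + b , inverse⁻⁺ {+ m} {+ a} {+ b} (pos-Bézout {a} {p} {b} {m} eq)

  inverse : ∀ {x} → x ≉0 → ∃ λ y → x * y ≈ 1ℤ
  inverse {+ m} x≉0 = inverse-ℕ (x≉0 ∘ ∣⇒≈0)
  inverse { -[1+ k ]} x≉0 with inverse-ℕ (x≉0 ∘ ∣⇒≈0)
  ... | y , xy≈1 = - y , neg-inverse {+ Nat.suc k} {y} xy≈1
    where
    neg-inverse : ∀ {x y} → x * y ≈ 1ℤ → - x * - y ≈ 1ℤ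
    neg-inverse {x} {y} = ≈-trans (≈-reflexive (solve (x ∷ y ∷ [])))

  *≈1⇒≉0ʳ : ∀ x {y} → x * y ≈ 1ℤ → y ≉0
  *≈1⇒≉0ʳ x xy≈1 = ≉0-*-invʳ x (≉0-resp (≈-sym xy≈1) 1≉0)

diagonal : ℤ → ℤ → Mat
diagonal x y = mat x 0ℤ 0ℤ y

antidiagonal : ℤ → ℤ → Mat
antidiagonal u w = mat 0ℤ u w 0ℤ

scalar : ℤ → Mat
scalar y = diagonal y y

det-diagonal : ∀ x y → det (diagonal x y) ≡ x * y
det-diagonal x y = ℤ.+-identityʳ (x * y)

det-antidiagonal : ∀ u w → det (antidiagonal u w) ≡ - (u * w)
det-antidiagonal u w = ℤ.+-identityˡ (- (u * w))

cusp-≡ : ∀ {x x' y y' e e'} → x ≡ x' → y ≡ y' → e ≡ e' → cusp x y e ≡ cusp x' y' e'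
cusp-≡ refl refl refl = refl

det-· : ∀ g h → det (g · h) ≡ det g * det h
det-· (mat a b c d) (mat a' b' c' d') = expanded a b c d a' b' c' d'
  where
  expanded : ∀ a b c d a' b' c' d' →
    (a * a' + b * c') * (c * b' + d * d') - (a * b' + b * d') * (c * a' + d * c')
      ≡ (a * d - b * c) * (a' * d' - b' * c')
  expanded = solve-∀

act-· : ∀ g h c → act (g · h) c ≡ act g (act h c)
act-· g@(mat a b c d) h@(mat a' b' c' d') (cusp x y e) = cusp-≡ (row a b) (row c d) (begin
  det (g · h) * e        ≡⟨ cong (_* e) (det-· g h) ⟩
  det g * det h * e      ≡⟨ ℤ.*-assoc (det g) (det h) e ⟩
  det g * (det h * e)    ∎)
  where
  open ≡-Reasoning
  row : ∀ a b → (a * a' + b * c') * x + (a * b' + b * d') * y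
                ≡ a * (a' * x + b' * y) + b * (c' * x + d' * y)
  row a b = solve (a ∷ b ∷ a' ∷ b' ∷ c' ∷ d' ∷ x ∷ y ∷ [])

act-diagonal-atInfinity : ∀ t a → act (diagonal t 1ℤ) (cusp a 0ℤ a) ≡ cusp (t * a) 0ℤ (t * a)
act-diagonal-atInfinity t a =
  cusp-≡ (ℤ.+-identityʳ (t * a)) refl (cong (_* a) (trans (det-diagonal t 1ℤ) (ℤ.*-identityʳ t)))

module Coordinatewise (p : ℕ) where

  open Congruence p

  infix 4 _≈ᴹ_ _≈ᶜ_

  data _≈ᴹ_ : Mat → Mat → Set where
    mat-cong : ∀ {a b c d a' b' c' d'} → a ≈ a' → b ≈ b' → c ≈ c' → d ≈ d' →
               mat a b c d ≈ᴹ mat a' b' c' d'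

  data _≈ᶜ_ : CuspRep → CuspRep → Set where
    cusp-cong : ∀ {x y e x' y' e'} → x ≈ x' → y ≈ y' → e ≈ e' → cusp x y e ≈ᶜ cusp x' y' e'

  ≈ᴹ⇒MatEq : ∀ {g h} → g ≈ᴹ h → MatEq p g h
  ≈ᴹ⇒MatEq (mat-cong a b c d) = toMod a , toMod b , toMod c , toMod d

  det-cong : ∀ {g h} → g ≈ᴹ h → det g ≈ det h
  det-cong (mat-cong a b c d) = -‿cong (*-cong a d) (*-cong b c)

  act-cong : ∀ {g h} c → g ≈ᴹ h → act g c ≈ᶜ act h c
  act-cong (cusp x y e) g≈h@(mat-cong a b c d) = cusp-cong
    (+-cong (*-cong a (≈-refl {x})) (*-cong b (≈-refl {y})))
    (+-cong (*-cong c (≈-refl {x})) (*-cong d (≈-refl {y})))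
    (*-cong (det-cong g≈h) (≈-refl {e}))

  CuspEq-respˡ : ∀ {c c'} c'' → c ≈ᶜ c' → CuspEq p c' c'' → CuspEq p c c''
  CuspEq-respˡ {cusp x y e} {cusp x' y' e'} (cusp x'' y'' e'')
    (cusp-cong x≈x' y≈y' e≈e') (signs , e'≡e'') =
    resp signs , toMod (≈-trans e≈e' (fromMod e'≡e''))
    where
    resp : (x' ≡ x'' [mod p ] × y' ≡ y'' [mod p ]) ⊎ (x' ≡ - x'' [mod p ] × y' ≡ - y'' [mod p ]) →
           (x ≡ x'' [mod p ] × y ≡ y'' [mod p ]) ⊎ (x ≡ - x'' [mod p ] × y ≡ - y'' [mod p ])
    resp (inj₁ (x'≡x'' , y'≡y'')) =
      inj₁ (toMod (≈-trans x≈x' (fromMod x'≡x'')) , toMod (≈-trans y≈y' (fromMod y'≡y'')))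
    resp (inj₂ (x'≡-x'' , y'≡-y'')) =
      inj₂ (toMod (≈-trans x≈x' (fromMod x'≡-x'')) , toMod (≈-trans y≈y' (fromMod y'≡-y'')))

module TorusReduction {p : ℕ} (prime : Prime p) where

  open Congruence p
  open Coordinatewise p
  open PrimeField prime

  InProductWithTorus : (Mat → Set) → Mat → Set
  InProductWithTorus H g = ∃₂ λ h t → H h × t ≉0 × h · diagonal t 1ℤ ≈ᴹ g

  AtInfinity-fromFactorisation : ∀ {G H : Mat → Set} → (∀ g → G g → InProductWithTorus H g) →
    ∀ c → AtInfinity p G c → AtInfinity p H c
  AtInfinity-fromFactorisation factor c (g , a , g∈G , a≢0 , ga~c) with factor g g∈G
  ... | h , t , h∈H , t≉0 , ht≈g =
    h , t * a , h∈H , ≉0⇒NonZeroMod (≉0-* t≉0 (NonZeroMod⇒≉0 a≢0)) ,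
    CuspEq-respˡ c (subst (_≈ᶜ act g (cusp a 0ℤ a)) act-ht (act-cong (cusp a 0ℤ a) ht≈g)) ga~c
    where
    act-ht : act (h · diagonal t 1ℤ) (cusp a 0ℤ a) ≡ act h (cusp (t * a) 0ℤ (t * a))
    act-ht = trans (act-· h (diagonal t 1ℤ) (cusp a 0ℤ a))
                   (cong (act h) (act-diagonal-atInfinity t a))

module SplitCartanNormaliser {p : ℕ} (prime : Prime p) (ε : ℤ) (ε≉0 : Congruence._≉0 p ε) where

  open Congruence p
  open Coordinatewise p
  open PrimeField prime
  open TorusReduction prime

  scalar∈Cns : ∀ {y} → y ≉0 → InCns p ε (scalar y)
  scalar∈Cns {y} y≉0 =
    y , 0ℤ , (λ (y≡0 , _) → y≉0 (fromMod y≡0)) ,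
    ≈ᴹ⇒MatEq (mat-cong (≈-refl {y}) (≈-reflexive (sym (ℤ.*-zeroʳ ε))) (≈-refl {0ℤ}) (≈-refl {y}))

  antidiagonal∈Cns : ∀ {b} → b ≉0 → InCns p ε (antidiagonal (ε * b) b)
  antidiagonal∈Cns {b} b≉0 =
    0ℤ , b , (λ (_ , b≡0) → b≉0 (fromMod b≡0)) ,
    ≈ᴹ⇒MatEq (mat-cong (≈-refl {0ℤ}) (≈-refl {ε * b}) (≈-refl {b}) (≈-refl {0ℤ}))

  diagonal∈Nsp : ∀ {x y} → x ≉0 → y ≉0 → InNsp p (diagonal x y)
  diagonal∈Nsp {x} {y} x≉0 y≉0 =
    ≉0⇒NonZeroMod (≉0-resp (≈-reflexive (sym (det-diagonal x y))) (≉0-* x≉0 y≉0)) ,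
    inj₁ (toMod (≈-refl {0ℤ}) , toMod (≈-refl {0ℤ}))

  antidiagonal∈Nsp : ∀ {u w} → u ≉0 → w ≉0 → InNsp p (antidiagonal u w)
  antidiagonal∈Nsp {u} {w} u≉0 w≉0 =
    ≉0⇒NonZeroMod (≉0-resp (≈-reflexive (sym (det-antidiagonal u w))) (≉0-neg (≉0-* u≉0 w≉0))) ,
    inj₂ (toMod (≈-refl {0ℤ}) , toMod (≈-refl {0ℤ}))

  scalar∈H : ∀ {y} → y ≉0 → InH p ε (scalar y)
  scalar∈H y≉0 = inj₁ (scalar∈Cns y≉0) , diagonal∈Nsp y≉0 y≉0

  antidiagonal∈H : ∀ {b} → b ≉0 → InH p ε (antidiagonal (ε * b) b)
  antidiagonal∈H b≉0 = inj₁ (antidiagonal∈Cns b≉0) , antidiagonal∈Nsp (≉0-* ε≉0 b≉0) b≉0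

  scalar·diagonal≈ : ∀ {x u w y z} → u ≈ 0ℤ → w ≈ 0ℤ → y * z ≈ 1ℤ →
    scalar y · diagonal (x * z) 1ℤ ≈ᴹ mat x u w y
  scalar·diagonal≈ {x} {u} {w} {y} {z} u≈0 w≈0 yz≈1 = mat-cong
    (begin
      y * (x * z) + 0ℤ * 0ℤ  ≡⟨ solve (x ∷ y ∷ z ∷ []) ⟩
      x * (y * z)            ≈⟨ *-cong (≈-refl {x}) yz≈1 ⟩
      x * 1ℤ                 ≡⟨ ℤ.*-identityʳ x ⟩
      x                      ∎)
    (begin
      y * 0ℤ + 0ℤ * 1ℤ  ≡⟨ solve (y ∷ []) ⟩
      0ℤ                ≈⟨ ≈-sym u≈0 ⟩
      u                 ∎)
    (begin
      0ℤ * (x * z) + y * 0ℤ  ≡⟨ solve (x ∷ y ∷ z ∷ []) ⟩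
      0ℤ                     ≈⟨ ≈-sym w≈0 ⟩
      w                      ∎)
    (begin
      0ℤ * 0ℤ + y * 1ℤ  ≡⟨ solve (y ∷ []) ⟩
      y                 ∎)
    where open ≈-Reasoning

  antidiagonal·diagonal≈ : ∀ {x u w y e v} → x ≈ 0ℤ → y ≈ 0ℤ → ε * e ≈ 1ℤ → u * v ≈ 1ℤ →
    antidiagonal (ε * (u * e)) (u * e) · diagonal (w * ε * v) 1ℤ ≈ᴹ mat x u w y
  antidiagonal·diagonal≈ {x} {u} {w} {y} {e} {v} x≈0 y≈0 εe≈1 uv≈1 = mat-cong
    (begin
      0ℤ * (w * ε * v) + ε * (u * e) * 0ℤ  ≡⟨ solve (u ∷ w ∷ ε ∷ e ∷ v ∷ []) ⟩
      0ℤ                                   ≈⟨ ≈-sym x≈0 ⟩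
      x                                    ∎)
    (begin
      0ℤ * 0ℤ + ε * (u * e) * 1ℤ  ≡⟨ solve (u ∷ ε ∷ e ∷ []) ⟩
      u * (ε * e)                 ≈⟨ *-cong (≈-refl {u}) εe≈1 ⟩
      u * 1ℤ                      ≡⟨ ℤ.*-identityʳ u ⟩
      u                           ∎)
    (begin
      u * e * (w * ε * v) + 0ℤ * 0ℤ  ≡⟨ solve (u ∷ w ∷ ε ∷ e ∷ v ∷ []) ⟩
      w * ((ε * e) * (u * v))        ≈⟨ *-cong (≈-refl {w}) (*-cong εe≈1 uv≈1) ⟩
      w * 1ℤ                         ≡⟨ ℤ.*-identityʳ w ⟩
      w                              ∎)
    (begin
      u * e * 0ℤ + 0ℤ * 1ℤ  ≡⟨ solve (u ∷ e ∷ []) ⟩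
      0ℤ                    ≈⟨ ≈-sym y≈0 ⟩
      y                     ∎)
    where open ≈-Reasoning

  diagonal-factorisation : ∀ {x u w y} → u ≈ 0ℤ → w ≈ 0ℤ → det (mat x u w y) ≉0 →
    InProductWithTorus (InH p ε) (mat x u w y)
  diagonal-factorisation {x} {u} {w} {y} u≈0 w≈0 det≉0 =
    let (z , yz≈1) = inverse y≉0 in
    scalar y , x * z , scalar∈H y≉0 , ≉0-* x≉0 (*≈1⇒≉0ʳ y yz≈1) , scalar·diagonal≈ u≈0 w≈0 yz≈1
    where
    xy≉0 : x * y ≉0
    xy≉0 = ≉0-resp det≈xy det≉0
      where
      det≈xy : det (mat x u w y) ≈ x * y
      det≈xy = ≈-trans (det-cong (mat-cong (≈-refl {x}) u≈0 w≈0 (≈-refl {y})))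
                       (≈-reflexive (det-diagonal x y))
    x≉0 : x ≉0
    x≉0 = ≉0-*-invˡ xy≉0
    y≉0 : y ≉0
    y≉0 = ≉0-*-invʳ x xy≉0

  antidiagonal-factorisation : ∀ {x u w y} → x ≈ 0ℤ → y ≈ 0ℤ → det (mat x u w y) ≉0 →
    InProductWithTorus (InH p ε) (mat x u w y)
  antidiagonal-factorisation {x} {u} {w} {y} x≈0 y≈0 det≉0 =
    let (e , εe≈1) = inverse ε≉0
        (v , uv≈1) = inverse u≉0
    in
    antidiagonal (ε * (u * e)) (u * e) , w * ε * v ,
    antidiagonal∈H (≉0-* u≉0 (*≈1⇒≉0ʳ ε εe≈1)) ,
    ≉0-* (≉0-* w≉0 ε≉0) (*≈1⇒≉0ʳ u uv≈1) ,
    antidiagonal·diagonal≈ x≈0 y≈0 εe≈1 uv≈1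
    where
    uw≉0 : u * w ≉0
    uw≉0 = ≉0-resp (≈-reflexive (ℤ.neg-involutive (u * w))) (≉0-neg (≉0-resp det≈-uw det≉0))
      where
      det≈-uw : det (mat x u w y) ≈ - (u * w)
      det≈-uw = ≈-trans (det-cong (mat-cong x≈0 (≈-refl {u}) (≈-refl {w}) y≈0))
                        (≈-reflexive (det-antidiagonal u w))
    u≉0 : u ≉0
    u≉0 = ≉0-*-invˡ uw≉0
    w≉0 : w ≉0
    w≉0 = ≉0-*-invʳ u uw≉0

  Nsp⊆H·T : ∀ g → InNsp p g → InProductWithTorus (InH p ε) g
  Nsp⊆H·T (mat x u w y) (det≢0 , inj₁ (u≡0 , w≡0)) =
    diagonal-factorisation (fromMod u≡0) (fromMod w≡0) (NonZeroMod⇒≉0 det≢0)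
  Nsp⊆H·T (mat x u w y) (det≢0 , inj₂ (x≡0 , y≡0)) =
    antidiagonal-factorisation (fromMod x≡0) (fromMod y≡0) (NonZeroMod⇒≉0 det≢0)

lemma3p4 : (p : ℕ) → Prime p → p ≢ 2 → (ε : ℤ) → IsGenerator p ε →
    (c : CuspRep) → ValidCusp p c →
    ¬ AtInfinity p (InH p ε) c → ¬ AtInfinity p (InNsp p) c
lemma3p4 p p-prime _ ε (ε≢0 , _) c _ c∉H∞ = c∉H∞ ∘ AtInfinity-fromFactorisation Nsp⊆H·T c
  where
  open TorusReduction p-prime
  open SplitCartanNormaliser p-prime ε (Congruence.NonZeroMod⇒≉0 p ε≢0)
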